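{- Let $p\in \mathbb{Z}[z]$ be a polynomial of degree at least 2 with a positive leading coefficient, and let $a,b$ be positive integers with $\gcd(a,b)=1$. Let $d\ge 1$ and $t$ be integers such that $(a+b)t\equiv p(t)\pmod{d}$. Then for any $K\in \mathbb{Z}^{+}$ there exists a solution $(x,y,z)$ of $ax+by=p(z)$ in integers such that $x,y,z\ge K$ and $x\equiv y\equiv z\equiv t \pmod d$. -}

module Defs where

open import Data.Nat using (ℕ)
open import Data.List using (List; []; _∷_; length)
open import Data.Integer using (ℤ; _+_; _*_; _-_; _^_; 0ℤ)
open import Data.Integer.Divisibility using (_∣_)

-- A polynomial in ℤ[z] with a nonzero leading coefficient, presented as
-- its list of lower coefficients [c₀, c₁, …, c_{n-1}] (constant first)
-- together with its leading coefficient cₙ.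
record Poly : Set where
  constructor poly
  field
    lower   : List ℤ
    leading : ℤ

evalList : List ℤ → ℤ → ℤ
evalList []       z = 0ℤ
evalList (c ∷ cs) z = c + z * evalList cs z

degree : Poly → ℕ
degree p = length (Poly.lower p)

leadingCoeff : Poly → ℤ
leadingCoeff p = Poly.leading p

eval : Poly → ℤ → ℤ
eval p z = evalList (Poly.lower p) z + Poly.leading p * z ^ degree p

infix 4 _≅_[mod_]
_≅_[mod_] : ℤ → ℤ → ℤ → Set
x ≅ y [mod d ] = d ∣ (x - y)

{-# OPTIONS --safe #-}
module Submission where

-- Put L = |K| + |t| and pick z ≡ t (mod d) so large that
-- p(z) ≥ (a+b)t + d((a+b)L + ab). As p(z) ≡ p(t) ≡ (a+b)t (mod d), we get
-- p(z) = (a+b)t + dN with N ≥ (a+b)L + ab. Coprimality makes every M ≥ ab a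
-- combination au' + bv' with u', v' ≥ 0 (take u' ≡ sM mod b for a Bézout
-- coefficient s), so N = au + bv with u, v ≥ L, and x = t + du, y = t + dv work.

open import Data.List using (List; []; _∷_; length)
open import Data.Nat as ℕ using (ℕ; zero; suc; z≤n; s≤s) renaming (_≥_ to _≥ℕ_)
import Data.Nat.Properties as ℕ
import Data.Nat.GCD as ℕ
import Data.Nat.Tactic.RingSolver as ℕ-Solver
open import Data.Integer
  using (ℤ; _+_; _*_; _-_; _^_; -_; _≤_; _>_; _≥_; _⊔_; +_; -[1+_]; 0ℤ; 1ℤ; ∣_∣; +≤+; -≤+; Positive; NonNegative; NonZero; >-nonZero; positive; nonNegative)
import Data.Integer.Properties as ℤ
open import Data.Integer.DivMod using (_/_; _%_; a≡a%n+[a/n]*n; n%d<d)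
open import Data.Integer.Divisibility.Signed using (divides; ∣ᵤ⇒∣; ∣⇒∣ᵤ; ∣m∣n⇒∣m+n; ∣m⇒∣-m; ∣m⇒∣m*n; ∣n⇒∣m*n)
  renaming (_∣_ to _∣ₛ_)
open import Data.Integer.GCD using (gcd)
open import Data.Integer.Tactic.RingSolver using (solve; solve-∀)
open import Data.Product using (_×_; _,_; ∃-syntax)
open import Function using (case_of_)
open import Relation.Binary.PropositionalEquality
open import Defs

-- The congruence of Defs unfolds to a divisibility of absolute values, from
-- which Agda cannot recover the operands; this record keeps them visible.
infix 4 _≈_[mod_]
record _≈_[mod_] (x y d : ℤ) : Set where
  constructor ≈-mod
  field
    divides-difference : d ∣ₛ x - y

≈⇒≅ : ∀ {d x y} → x ≈ y [mod d ] → x ≅ y [mod d ]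
≈⇒≅ (≈-mod d∣x-y) = ∣⇒∣ᵤ d∣x-y

≅⇒≈ : ∀ {d x y} → x ≅ y [mod d ] → x ≈ y [mod d ]
≅⇒≈ x≅y = ≈-mod (∣ᵤ⇒∣ x≅y)

≈-refl : ∀ {d} x → x ≈ x [mod d ]
≈-refl {d} x = ≈-mod (divides 0ℤ (trans (ℤ.+-inverseʳ x) (sym (ℤ.*-zeroˡ d))))

≈-sym : ∀ {d x y} → x ≈ y [mod d ] → y ≈ x [mod d ]
≈-sym {d} {x} {y} (≈-mod d∣x-y) = ≈-mod (subst (d ∣ₛ_) identity (∣m⇒∣-m d∣x-y))
  where
  identity : - (x - y) ≡ y - x
  identity = solve (x ∷ y ∷ [])

≈-trans : ∀ {d x y z} → x ≈ y [mod d ] → y ≈ z [mod d ] → x ≈ z [mod d ]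
≈-trans {d} {x} {y} {z} (≈-mod d∣x-y) (≈-mod d∣y-z) =
  ≈-mod (subst (d ∣ₛ_) identity (∣m∣n⇒∣m+n d∣x-y d∣y-z))
  where
  identity : (x - y) + (y - z) ≡ x - z
  identity = solve (x ∷ y ∷ z ∷ [])

≈-+ : ∀ {d x y u v} → x ≈ y [mod d ] → u ≈ v [mod d ] → x + u ≈ y + v [mod d ]
≈-+ {d} {x} {y} {u} {v} (≈-mod d∣x-y) (≈-mod d∣u-v) =
  ≈-mod (subst (d ∣ₛ_) identity (∣m∣n⇒∣m+n d∣x-y d∣u-v))
  where
  identity : (x - y) + (u - v) ≡ (x + u) - (y + v)
  identity = solve (x ∷ y ∷ u ∷ v ∷ [])

≈-* : ∀ {d x y u v} → x ≈ y [mod d ] → u ≈ v [mod d ] → x * u ≈ y * v [mod d ]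
≈-* {d} {x} {y} {u} {v} (≈-mod d∣x-y) (≈-mod d∣u-v) =
  ≈-mod (subst (d ∣ₛ_) identity (∣m∣n⇒∣m+n (∣n⇒∣m*n x d∣u-v) (∣m⇒∣m*n v d∣x-y)))
  where
  identity : x * (u - v) + (x - y) * v ≡ x * u - y * v
  identity = solve (x ∷ y ∷ u ∷ v ∷ [])

^-≈ : ∀ {d x y} → x ≈ y [mod d ] → ∀ n → x ^ n ≈ y ^ n [mod d ]
^-≈ x≈y zero    = ≈-refl 1ℤ
^-≈ x≈y (suc n) = ≈-* x≈y (^-≈ x≈y n)

evalList-≈ : ∀ {d x y} → x ≈ y [mod d ] → ∀ cs → evalList cs x ≈ evalList cs y [mod d ]
evalList-≈ x≈y []       = ≈-refl 0ℤ
evalList-≈ x≈y (c ∷ cs) = ≈-+ (≈-refl c) (≈-* x≈y (evalList-≈ x≈y cs))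

eval-≈ : ∀ p {d x y} → x ≈ y [mod d ] → eval p x ≈ eval p y [mod d ]
eval-≈ (poly cs c) x≈y = ≈-+ (evalList-≈ x≈y cs) (≈-* (≈-refl c) (^-≈ x≈y (length cs)))

t+d*u≈t : ∀ t d u → t + d * u ≈ t [mod d ]
t+d*u≈t t d u = ≈-mod (divides u (solve (t ∷ d ∷ u ∷ [])))

i≤+∣i∣ : ∀ i → i ≤ + ∣ i ∣
i≤+∣i∣ (+ n)    = ℤ.≤-refl
i≤+∣i∣ -[1+ n ] = -≤+

-∣i∣≤i : ∀ i → - + ∣ i ∣ ≤ i
-∣i∣≤i (+ n)    = ℤ.neg-≤-pos
-∣i∣≤i -[1+ n ] = ℤ.≤-refl

i≡-j+[i+j] : ∀ i j → i ≡ - j + (i + j)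
i≡-j+[i+j] i j = solve (i ∷ j ∷ [])

i≤j*i : ∀ {i} j .{{_ : Positive j}} → 0ℤ ≤ i → i ≤ j * i
i≤j*i {i} j 0≤i = subst (_≤ j * i) (ℤ.*-identityˡ i)
  (ℤ.*-monoʳ-≤-nonNeg i {{nonNegative 0≤i}} (ℤ.i<j⇒suc[i]≤j (ℤ.positive⁻¹ j)))

pos-^ : ∀ m n → (+ m) ^ n ≡ + (m ℕ.^ n)
pos-^ m zero    = refl
pos-^ m (suc n) = trans (cong (+ m *_) (pos-^ m n)) (sym (ℤ.pos-* m (m ℕ.^ n)))

m≤m^n : ∀ m {n} → 1 ℕ.≤ n → m ℕ.≤ m ℕ.^ n
m≤m^n zero    {suc n} _ = z≤n
m≤m^n (suc m) {suc n} _ = ℕ.m≤m*n (suc m) (suc m ℕ.^ n) {{ℕ.m^n≢0 (suc m) n}}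

absSum : List ℤ → ℕ
absSum []       = 0
absSum (c ∷ cs) = ∣ c ∣ ℕ.+ absSum cs

-- The factor z on the left keeps the exponent at length cs instead of length cs ∸ 1.
∣evalList∣*z≤absSum*z^length : ∀ cs z → ∣ evalList cs (+ z) ∣ ℕ.* z ℕ.≤ absSum cs ℕ.* z ℕ.^ length cs
∣evalList∣*z≤absSum*z^length []       z = z≤n
∣evalList∣*z≤absSum*z^length (c ∷ cs) z = begin
  ∣ c + + z * E ∣ ℕ.* z                             ≤⟨ ℕ.*-monoˡ-≤ z (ℤ.∣i+j∣≤∣i∣+∣j∣ c (+ z * E)) ⟩
  (∣ c ∣ ℕ.+ ∣ + z * E ∣) ℕ.* z                     ≡⟨ cong (λ e → (∣ c ∣ ℕ.+ e) ℕ.* z) (ℤ.abs-* (+ z) E) ⟩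
  (∣ c ∣ ℕ.+ z ℕ.* ∣ E ∣) ℕ.* z                     ≡⟨ expand (∣ c ∣) z (∣ E ∣) ⟩
  ∣ c ∣ ℕ.* z ℕ.+ z ℕ.* (∣ E ∣ ℕ.* z)               ≤⟨ ℕ.+-mono-≤ (ℕ.*-monoʳ-≤ ∣ c ∣ (m≤m^n z {suc n} (s≤s z≤n)))
                                                                    (ℕ.*-monoʳ-≤ z (∣evalList∣*z≤absSum*z^length cs z)) ⟩
  ∣ c ∣ ℕ.* z ℕ.^ suc n ℕ.+ z ℕ.* (absSum cs ℕ.* z ℕ.^ n) ≡⟨ collect (∣ c ∣) z (absSum cs) (z ℕ.^ n) ⟩
  (∣ c ∣ ℕ.+ absSum cs) ℕ.* z ℕ.^ suc n              ∎
  where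
  open ℕ.≤-Reasoning
  E = evalList cs (+ z)
  n = length cs
  expand : ∀ c z e → (c ℕ.+ z ℕ.* e) ℕ.* z ≡ c ℕ.* z ℕ.+ z ℕ.* (e ℕ.* z)
  expand = ℕ-Solver.solve-∀
  collect : ∀ c z s zⁿ → c ℕ.* (z ℕ.* zⁿ) ℕ.+ z ℕ.* (s ℕ.* zⁿ) ≡ (c ℕ.+ s) ℕ.* (z ℕ.* zⁿ)
  collect = ℕ-Solver.solve-∀

w+∣evalList∣≤z^length : ∀ cs {w z} → 1 ℕ.≤ length cs → w ℕ.+ absSum cs ℕ.≤ suc z →
                         w ℕ.+ ∣ evalList cs (+ suc z) ∣ ℕ.≤ suc z ℕ.^ length cs
w+∣evalList∣≤z^length cs {w} {z} 1≤n w+S≤z = ℕ.*-cancelʳ-≤ _ _ (suc z) (begin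
  (w ℕ.+ ∣ E ∣) ℕ.* suc z              ≡⟨ ℕ.*-distribʳ-+ (suc z) w ∣ E ∣ ⟩
  w ℕ.* suc z ℕ.+ ∣ E ∣ ℕ.* suc z      ≤⟨ ℕ.+-mono-≤ (ℕ.*-monoʳ-≤ w (m≤m^n (suc z) 1≤n))
                                                       (∣evalList∣*z≤absSum*z^length cs (suc z)) ⟩
  w ℕ.* zⁿ ℕ.+ absSum cs ℕ.* zⁿ         ≡⟨ ℕ.*-distribʳ-+ zⁿ w (absSum cs) ⟨
  (w ℕ.+ absSum cs) ℕ.* zⁿ             ≤⟨ ℕ.*-monoˡ-≤ zⁿ w+S≤z ⟩
  suc z ℕ.* zⁿ                         ≡⟨ ℕ.*-comm (suc z) zⁿ ⟩
  zⁿ ℕ.* suc z                         ∎)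
  where
  open ℕ.≤-Reasoning
  E = evalList cs (+ suc z)
  zⁿ = suc z ℕ.^ length cs

-- Beyond the threshold, p(z) ≥ z ^ n − ∣ lower part ∣ ≥ z ^ n − absSum · z ^ (n − 1) ≥ ∣ B ∣.
threshold : Poly → ℤ → ℤ
threshold p B = + suc (∣ B ∣ ℕ.+ absSum (Poly.lower p))

eval-≥ : ∀ p → degree p ≥ℕ 1 → leadingCoeff p > 0ℤ → ∀ B {z} → threshold p B ≤ z → B ≤ eval p z
eval-≥ (poly cs c) 1≤n c>0 B {+ suc z} (+≤+ (s≤s B+S≤z)) = begin
  B                                   ≤⟨ i≤+∣i∣ B ⟩
  + ∣ B ∣                             ≡⟨ i≡-j+[i+j] (+ ∣ B ∣) (+ ∣ E ∣) ⟩
  - + ∣ E ∣ + (+ ∣ B ∣ + + ∣ E ∣)     ≤⟨ ℤ.+-mono-≤ (-∣i∣≤i E) (+≤+ ∣B∣+∣E∣≤zⁿ) ⟩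
  E + + (suc z ℕ.^ n)                 ≤⟨ ℤ.+-monoʳ-≤ E (i≤j*i c {{positive c>0}} (+≤+ z≤n)) ⟩
  E + c * + (suc z ℕ.^ n)             ≡⟨ cong (λ zⁿ → E + c * zⁿ) (pos-^ (suc z) n) ⟨
  E + c * (+ suc z) ^ n               ∎
  where
  open ℤ.≤-Reasoning
  E = evalList cs (+ suc z)
  n = length cs
  ∣B∣+∣E∣≤zⁿ : ∣ B ∣ ℕ.+ ∣ E ∣ ℕ.≤ suc z ℕ.^ n
  ∣B∣+∣E∣≤zⁿ = w+∣evalList∣≤z^length cs 1≤n (ℕ.m≤n⇒m≤1+n B+S≤z)

1+yn≡xm⇒mx-ny≡1 : ∀ {m n x y} → 1 ℕ.+ y ℕ.* n ≡ x ℕ.* m → + m * + x + + n * - + y ≡ 1ℤ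
1+yn≡xm⇒mx-ny≡1 {m} {n} {x} {y} eq = begin
  + m * + x + + n * - + y          ≡⟨ rearrange (+ m) (+ n) (+ x) (+ y) ⟩
  + x * + m - + y * + n            ≡⟨ cong₂ _-_ (ℤ.pos-* x m) (ℤ.pos-* y n) ⟨
  + (x ℕ.* m) - + (y ℕ.* n)        ≡⟨ cong (λ k → + k - + (y ℕ.* n)) eq ⟨
  1ℤ + + (y ℕ.* n) - + (y ℕ.* n)   ≡⟨ cancel (+ (y ℕ.* n)) ⟩
  1ℤ                               ∎
  where
  open ≡-Reasoning
  rearrange : ∀ m n x y → m * x + n * - y ≡ x * m - y * n
  rearrange = solve-∀
  cancel : ∀ k → 1ℤ + k - k ≡ 1ℤ
  cancel = solve-∀

bézout : ∀ {i j} → 0ℤ ≤ i → 0ℤ ≤ j → gcd i j ≡ 1ℤ → ∃[ s ] ∃[ r ] i * s + j * r ≡ 1ℤ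
bézout {+ m} {+ n} _ _ gcd≡1 with ℕ.Bézout.identity (subst (ℕ.GCD m n) (ℤ.+-injective gcd≡1) (ℕ.gcd-GCD m n))
... | ℕ.Bézout.+- x y eq = + x , - + y , 1+yn≡xm⇒mx-ny≡1 {m} {n} eq
... | ℕ.Bézout.-+ x y eq = - + x , + y , trans (ℤ.+-comm (+ m * - + x) (+ n * + y)) (1+yn≡xm⇒mx-ny≡1 {n} {m} eq)

i+j-i≡j : ∀ i j → i + j - i ≡ j
i+j-i≡j = solve-∀

i+[j-i]≡j : ∀ i j → i + (j - i) ≡ j
i+[j-i]≡j = solve-∀

i+j≤k⇒j≤k-i : ∀ {i j k} → i + j ≤ k → j ≤ k - i
i+j≤k⇒j≤k-i {i} {j} {k} i+j≤k = subst (_≤ k - i) (i+j-i≡j i j) (ℤ.+-monoˡ-≤ (- i) i+j≤k)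

ab≤M⇒∃-nonneg-combination : ∀ a b {M} .{{_ : Positive a}} .{{_ : Positive b}} → gcd a b ≡ 1ℤ → a * b ≤ M →
                            ∃[ u ] ∃[ v ] 0ℤ ≤ u × 0ℤ ≤ v × a * u + b * v ≡ M
ab≤M⇒∃-nonneg-combination a b {M} gcd≡1 ab≤M
  with bézout (ℤ.<⇒≤ (ℤ.positive⁻¹ a)) (ℤ.<⇒≤ (ℤ.positive⁻¹ b)) gcd≡1
... | s , r , as+br≡1 = + ρ , v , +≤+ z≤n , 0≤v , combination
  where
  0≤b : 0ℤ ≤ b
  0≤b = ℤ.<⇒≤ (ℤ.positive⁻¹ b)
  instance
    b≢0 : NonZero b
    b≢0 = >-nonZero (ℤ.positive⁻¹ b)
    a≥0 : NonNegative a
    a≥0 = nonNegative (ℤ.<⇒≤ (ℤ.positive⁻¹ a))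
  ρ = (s * M) % b
  q = (s * M) / b
  v = r * M + a * q
  combination : a * + ρ + b * v ≡ M
  combination = begin
    a * + ρ + b * v              ≡⟨ regroup a b r M (+ ρ) q ⟩
    a * (+ ρ + q * b) + b * r * M ≡⟨ cong (λ sM → a * sM + b * r * M) (a≡a%n+[a/n]*n (s * M) b) ⟨
    a * (s * M) + b * r * M      ≡⟨ collect a b s r M ⟩
    (a * s + b * r) * M          ≡⟨ cong (_* M) as+br≡1 ⟩
    1ℤ * M                       ≡⟨ ℤ.*-identityˡ M ⟩
    M                            ∎
    where
    open ≡-Reasoning
    regroup : ∀ a b r M ρ q → a * ρ + b * (r * M + a * q) ≡ a * (ρ + q * b) + b * r * M
    regroup = solve-∀
    collect : ∀ a b s r M → a * (s * M) + b * r * M ≡ (a * s + b * r) * M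
    collect = solve-∀
  ρ≤b : + ρ ≤ b
  ρ≤b = subst (+ ρ ≤_) (ℤ.0≤i⇒+∣i∣≡i 0≤b) (+≤+ (ℕ.<⇒≤ (n%d<d (s * M) b)))
  0≤v : 0ℤ ≤ v
  0≤v = ℤ.*-cancelˡ-≤-pos 0ℤ v b (begin
    b * 0ℤ                        ≡⟨ ℤ.*-zeroʳ b ⟩
    0ℤ                            ≤⟨ ℤ.i≤j⇒0≤j-i (ℤ.≤-trans (ℤ.*-monoˡ-≤-nonNeg a ρ≤b) ab≤M) ⟩
    M - a * + ρ                   ≡⟨ cong (_- a * + ρ) combination ⟨
    a * + ρ + b * v - a * + ρ     ≡⟨ i+j-i≡j (a * + ρ) (b * v) ⟩
    b * v                         ∎)
    where open ℤ.≤-Reasoning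

∃-combination-≥ : ∀ a b {N} .{{_ : Positive a}} .{{_ : Positive b}} → gcd a b ≡ 1ℤ → ∀ L →
                  (a + b) * L + a * b ≤ N → ∃[ u ] ∃[ v ] L ≤ u × L ≤ v × a * u + b * v ≡ N
∃-combination-≥ a b {N} gcd≡1 L bound =
  case ab≤M⇒∃-nonneg-combination a b gcd≡1 (i+j≤k⇒j≤k-i bound) of λ where
    (u , v , 0≤u , 0≤v , au+bv≡M) →
      L + u , L + v , ℤ.i≤i+j L u {{nonNegative 0≤u}} , ℤ.i≤i+j L v {{nonNegative 0≤v}} , (begin
        a * (L + u) + b * (L + v)           ≡⟨ regroup a b L u v ⟩
        (a + b) * L + (a * u + b * v)       ≡⟨ cong (λ n → (a + b) * L + n) au+bv≡M ⟩
        (a + b) * L + (N - (a + b) * L)     ≡⟨ i+[j-i]≡j ((a + b) * L) N ⟩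
        N                                   ∎)
  where
  open ≡-Reasoning
  regroup : ∀ a b L u v → a * (L + u) + b * (L + v) ≡ (a + b) * L + (a * u + b * v)
  regroup = solve-∀

c+d*T≤P⇒T≤N : ∀ d {c T N P} .{{_ : Positive d}} → c + d * T ≤ P → P - c ≡ N * d → T ≤ N
c+d*T≤P⇒T≤N d {c} {T} {N} {P} c+dT≤P P-c≡Nd = ℤ.*-cancelʳ-≤-pos T N d (begin
  T * d   ≡⟨ ℤ.*-comm T d ⟩
  d * T   ≤⟨ i+j≤k⇒j≤k-i c+dT≤P ⟩
  P - c   ≡⟨ P-c≡Nd ⟩
  N * d   ∎)
  where open ℤ.≤-Reasoning

∃-congruent-combination : ∀ a b d {t P} .{{_ : Positive a}} .{{_ : Positive b}} .{{_ : Positive d}} →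
  gcd a b ≡ 1ℤ → P ≈ (a + b) * t [mod d ] → ∀ L → (a + b) * t + d * ((a + b) * L + a * b) ≤ P →
  ∃[ u ] ∃[ v ] L ≤ u × L ≤ v × a * (t + d * u) + b * (t + d * v) ≡ P
∃-congruent-combination a b d {t} {P} gcd≡1 (≈-mod (divides N P-[a+b]t≡Nd)) L bound =
  case ∃-combination-≥ a b gcd≡1 L (c+d*T≤P⇒T≤N d {N = N} bound P-[a+b]t≡Nd) of λ where
    (u , v , L≤u , L≤v , au+bv≡N) → u , v , L≤u , L≤v , (begin
      a * (t + d * u) + b * (t + d * v)   ≡⟨ regroup a b d t u v ⟩
      (a + b) * t + (a * u + b * v) * d   ≡⟨ cong (λ n → (a + b) * t + n * d) au+bv≡N ⟩
      (a + b) * t + N * d                 ≡⟨ cong (λ n → (a + b) * t + n) P-[a+b]t≡Nd ⟨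
      (a + b) * t + (P - (a + b) * t)     ≡⟨ i+[j-i]≡j ((a + b) * t) P ⟩
      P                                   ∎)
  where
  open ≡-Reasoning
  regroup : ∀ a b d t u v → a * (t + d * u) + b * (t + d * v) ≡ (a + b) * t + (a * u + b * v) * d
  regroup = solve-∀

∣K∣+∣t∣≤u⇒K≤t+d*u : ∀ K t d {u} .{{_ : Positive d}} → + ∣ K ∣ + + ∣ t ∣ ≤ u → K ≤ t + d * u
∣K∣+∣t∣≤u⇒K≤t+d*u K t d {u} L≤u = begin
  K                                  ≤⟨ i≤+∣i∣ K ⟩
  + ∣ K ∣                            ≡⟨ i≡-j+[i+j] (+ ∣ K ∣) (+ ∣ t ∣) ⟩
  - + ∣ t ∣ + (+ ∣ K ∣ + + ∣ t ∣)    ≤⟨ ℤ.+-mono-≤ (-∣i∣≤i t) L≤u ⟩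
  t + u                              ≤⟨ ℤ.+-monoʳ-≤ t (i≤j*i d (ℤ.≤-trans (+≤+ z≤n) L≤u)) ⟩
  t + d * u                          ∎
  where open ℤ.≤-Reasoning

lemma2p1 : (p : Poly) → degree p ≥ℕ 2 → leadingCoeff p > 0ℤ → (a b : ℤ) → a > 0ℤ → b > 0ℤ → gcd a b ≡ 1ℤ → (d t : ℤ) → d ≥ 1ℤ → ((a + b) * t ≅ eval p t [mod d ]) → (K : ℤ) → K > 0ℤ → ∃[ x ] ∃[ y ] ∃[ z ] ((a * x + b * y ≡ eval p z) × (K ≤ x × K ≤ y × K ≤ z) × (x ≅ t [mod d ] × y ≅ t [mod d ] × z ≅ t [mod d ]))
lemma2p1 p deg≥2 lc>0 a b a>0 b>0 gcd≡1 d t d≥1 [a+b]t≅p[t] K _ =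
  case ∃-congruent-combination a b d gcd≡1 p[z]≈[a+b]t L (eval-≥ p deg≥1 lc>0 B threshold≤z) of λ where
    (u , v , L≤u , L≤v , ax+by≡p[z]) →
      t + d * u , t + d * v , z , ax+by≡p[z] ,
      (∣K∣+∣t∣≤u⇒K≤t+d*u K t d L≤u , ∣K∣+∣t∣≤u⇒K≤t+d*u K t d L≤v , ℤ.≤-trans (ℤ.i≤i⊔j K (threshold p B)) Z≤z) ,
      (≈⇒≅ (t+d*u≈t t d u) , ≈⇒≅ (t+d*u≈t t d v) , ≈⇒≅ (t+d*u≈t t d m))
  where
  instance
    a⁺ : Positive a
    a⁺ = positive a>0
    b⁺ : Positive b
    b⁺ = positive b>0
    d⁺ : Positive d
    d⁺ = positive (ℤ.suc[i]≤j⇒i<j d≥1)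
  deg≥1 : degree p ≥ℕ 1
  deg≥1 = ℕ.≤-trans (s≤s z≤n) deg≥2
  L B Z m z : ℤ
  L = + ∣ K ∣ + + ∣ t ∣
  B = (a + b) * t + d * ((a + b) * L + a * b)
  Z = K ⊔ threshold p B
  m = + ∣ Z ∣ + + ∣ t ∣
  z = t + d * m
  Z≤z : Z ≤ z
  Z≤z = ∣K∣+∣t∣≤u⇒K≤t+d*u Z t d ℤ.≤-refl
  threshold≤z : threshold p B ≤ z
  threshold≤z = ℤ.≤-trans (ℤ.i≤j⊔i K (threshold p B)) Z≤z
  p[z]≈[a+b]t : eval p z ≈ (a + b) * t [mod d ]
  p[z]≈[a+b]t = ≈-trans (eval-≈ p (t+d*u≈t t d m)) (≈-sym (≅⇒≈ [a+b]t≅p[t]))
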